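{- Let $f:\mathbb{N}\to\mathbb{N}$ be a multiplicative function such that $f(p^{k-1})\le f(p^k)$ for every prime $p$ and integer $k\ge1$. A squarefree positive integer is $f$-practical if and only if it is weakly $f$-practical.
   Context: $\mathbb{N}$ denotes the positive integers. $S_f(n)=\sum_{d\mid n} f(d)$. A positive integer $n$ is $f$-practical if every positive integer $m\le S_f(n)$ can be written as $m=\sum_{d\in\mathcal{D}} f(d)$ for some set $\mathcal{D}$ of divisors of $n$. Write $n=p_1^{e_1}\cdots p_k^{e_k}$ with distinct primes indexed so that $f(p_1)\le\cdots\le f(p_k)$, and put $m_i=\prod_{j=1}^i p_j^{e_j}$ for $0\le i<k$ (so $m_0=1$); $n$ is weakly $f$-practical if $f(p_{i+1})\le S_f(m_i)+1$ for every $0\le i<k$. -}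

module Defs where

open import Data.Nat using (ℕ; zero; suc; _+_; _*_; _∸_; _^_; _≤_; _<_)
open import Data.Nat.Divisibility using (_∣_; _∣?_)
open import Data.Nat.Coprimality using (Coprime)
open import Data.Nat.Primality using (Prime)
open import Data.Nat.ListAction using (sum; product)
open import Data.List using (List; []; _∷_; map; filter; applyUpTo)
open import Data.List.Relation.Unary.All using (All)
open import Data.List.Relation.Unary.Unique.Propositional using (Unique)
open import Data.List.Relation.Unary.Linked using (Linked)
open import Data.List.Relation.Binary.Sublist.Propositional using (_⊆_)
open import Data.Product using (_×_; _,_; proj₁; proj₂; ∃-syntax)
open import Data.Unit using (⊤)
open import Relation.Binary.PropositionalEquality using (_≡_)
open import Relation.Nullary using (¬_)

divisors : ℕ → List ℕ
divisors n = filter (_∣? n) (applyUpTo suc n)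

S : (ℕ → ℕ) → ℕ → ℕ
S f n = sum (map f (divisors n))

Multiplicative : (ℕ → ℕ) → Set
Multiplicative f =
  f 1 ≡ 1 × (∀ m n → 1 ≤ m → 1 ≤ n → Coprime m n → f (m * n) ≡ f m * f n)

PositiveValued : (ℕ → ℕ) → Set
PositiveValued f = ∀ n → 1 ≤ n → 1 ≤ f n

-- n is f-practical: every 1 ≤ m ≤ S_f(n) is Σ_{d∈D} f(d) for a set D of
-- divisors of n (a set of divisors = a sublist of the duplicate-free list
-- of divisors).
FPractical : (ℕ → ℕ) → ℕ → Set
FPractical f n = ∀ m → 1 ≤ m → m ≤ S f n →
  ∃[ D ] (D ⊆ divisors n × sum (map f D) ≡ m)

-- A prime factorization of n, as a list of (p_i , e_i), with distinct primes,
-- positive exponents, indexed so that f(p_1) ≤ ... ≤ f(p_k).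
IsOrderedFactorization : (ℕ → ℕ) → ℕ → List (ℕ × ℕ) → Set
IsOrderedFactorization f n ps =
  All (λ pe → Prime (proj₁ pe) × 1 ≤ proj₂ pe) ps ×
  Unique (map proj₁ ps) ×
  Linked (λ a b → f (proj₁ a) ≤ f (proj₁ b)) ps ×
  product (map (λ pe → proj₁ pe ^ proj₂ pe) ps) ≡ n

-- WeakCond f m ps: with m = m_i the product of the prime powers already
-- processed, require f(p_{i+1}) ≤ S_f(m_i) + 1 for each remaining index.
WeakCond : (ℕ → ℕ) → ℕ → List (ℕ × ℕ) → Set
WeakCond f m [] = ⊤
WeakCond f m ((p , e) ∷ ps) = f p ≤ S f m + 1 × WeakCond f (m * p ^ e) ps

-- n is weakly f-practical (for the/any indexing of its prime factors
-- by nondecreasing f(p)); m_0 = 1.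
WeaklyFPractical : (ℕ → ℕ) → ℕ → Set
WeaklyFPractical f n =
  ∀ ps → IsOrderedFactorization f n ps → WeakCond f 1 ps

Squarefree : ℕ → Set
Squarefree n = ∀ p → Prime p → ¬ (p * p ∣ n)

-- A list of weights is complete when every number up to its sum is a sub-sum.
-- If ws is complete and 1 ≤ c ≤ Σ ws + 1, then ws ++ c·ws is complete, because
-- every x ≤ Σ ws + c Σ ws can be written a + c b with a, b ≤ Σ ws. For a prime p
-- not dividing m, the divisors of m p are those of m together with p times them,
-- so by multiplicativity the f-values of the divisors of m p are a permutation of
-- ws ++ f(p)·ws, where ws are those of m. Adding the primes of a squarefree n one
-- at a time, in the order of f, turns weak f-practicality into f-practicality.
-- Conversely, if f(p_{i+1}) > S_f(m_i) + 1, then every divisor d of n with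
-- f(d) ≤ S_f(m_i) + 1 divides m_i, since a prime factor p_j of d with j > i gives
-- f(d) ≥ f(p_j) ≥ f(p_{i+1}); so S_f(m_i) + 1 ≤ S_f(n) is not a sum of distinct f(d).

module Submission where

open import Defs
open import Data.Nat using (ℕ; _≤_; _∸_; _^_)
open import Data.Nat.Primality using (Prime)
open import Function.Bundles using (_⇔_; mk⇔)

open import Algebra.Properties.CommutativeSemigroup using (x∙yz≈y∙xz)
open import Data.Empty using (⊥-elim)
open import Data.List using (List; []; _∷_; map; filter; applyUpTo; _++_)
open import Data.List.Membership.Propositional using (_∈_)
open import Data.List.Membership.Propositional.Properties
  using (∈-filter⁺; ∈-filter⁻; ∈-applyUpTo⁺; ∈-map⁺; ∈-map⁻; ∈-++⁺ˡ; ∈-++⁺ʳ; ∈-++⁻)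
open import Data.List.Membership.Propositional.Properties.WithK using (unique∧set⇒bag)
open import Data.List.Properties using (map-++; map-∘; map-id; map-cong-local; filter-all)
open import Data.List.Relation.Binary.BagAndSetEquality using (∼bag⇒↭)
open import Data.List.Relation.Binary.Disjoint.Propositional using (Disjoint)
open import Data.List.Relation.Binary.Permutation.Propositional
  using (_↭_; ↭-refl; ↭-sym; ↭-trans; ↭-reflexive)
import Data.List.Relation.Binary.Permutation.Propositional as ↭
import Data.List.Relation.Binary.Permutation.Propositional.Properties as ↭
open import Data.List.Relation.Binary.Sublist.Propositional using (_⊆_; []; _∷_; _∷ʳ_)
import Data.List.Relation.Binary.Sublist.Propositional.Properties as Sublist
open import Data.List.Relation.Unary.All as All using (All; []; _∷_)
import Data.List.Relation.Unary.All.Properties as All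
open import Data.List.Relation.Unary.AllPairs using ([]; _∷_)
open import Data.List.Relation.Unary.Any using (here; there)
open import Data.List.Relation.Unary.Linked as Linked using (Linked)
import Data.List.Relation.Unary.Linked.Properties as Linked
open import Data.List.Relation.Unary.Unique.Propositional using (Unique)
import Data.List.Relation.Unary.Unique.Propositional.Properties as Unique
import Data.List.Sort
open import Data.Nat.Base
  using (zero; suc; _+_; _*_; _<_; z≤n; s≤s; s<s; NonZero; >-nonZero; >-nonZero⁻¹)
open import Data.Nat.Coprimality as Coprime using (Coprime; coprime-divisor)
open import Data.Nat.Divisibility
open import Data.Nat.DivMod using (_/_; _%_; m≡m%n+[m/n]*n; m%n<n; m*n/n≡m; /-monoˡ-≤)
open import Data.Nat.ListAction using (sum; product)
open import Data.Nat.ListAction.Properties using (sum-++; sum-↭; product-↭; ∈⇒∣product)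
open import Data.Nat.Primality using (prime⇒irreducible; prime⇒nonZero)
open import Data.Nat.Primality.Factorisation using (factorise; PrimeFactorisation)
open import Data.Nat.Properties
open import Data.Product using (_×_; _,_; proj₁; proj₂; ∃-syntax; ∃₂)
open import Data.Sum as Sum using (_⊎_; inj₁; inj₂)
open import Data.Unit using (tt)
open import Function.Base using (_∘_; id)
open import Function.Bundles using (module Equivalence)
import Relation.Binary.Construct.On as On
open import Relation.Binary.PropositionalEquality
  using (_≡_; refl; sym; trans; cong; cong₂; subst; module ≡-Reasoning)
open import Relation.Nullary using (¬_; yes; no)

open Equivalence using (to; from)

⊆-map⁻ : ∀ {A B : Set} (f : A → B) {ds : List B} {xs : List A} →
  ds ⊆ map f xs → ∃[ es ] (es ⊆ xs × map f es ≡ ds)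
⊆-map⁻ f {xs = []} [] = [] , [] , refl
⊆-map⁻ f {xs = x ∷ xs} (_ ∷ʳ τ) with es , σ , eq ← ⊆-map⁻ f τ =
  es , x ∷ʳ σ , eq
⊆-map⁻ f {xs = x ∷ xs} (refl ∷ τ) with es , σ , eq ← ⊆-map⁻ f τ =
  x ∷ es , refl ∷ σ , cong (f x ∷_) eq

⊆-transport-↭ : ∀ {A : Set} {ds xs ys : List A} →
  ds ⊆ xs → xs ↭ ys → ∃[ es ] (es ⊆ ys × es ↭ ds)
⊆-transport-↭ τ ↭.refl = _ , τ , ↭-refl
⊆-transport-↭ (_ ∷ʳ τ) (↭.prep x p)
  with es , σ , π ← ⊆-transport-↭ τ p = es , x ∷ʳ σ , π
⊆-transport-↭ (refl ∷ τ) (↭.prep x p)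
  with es , σ , π ← ⊆-transport-↭ τ p = x ∷ es , refl ∷ σ , ↭.prep x π
⊆-transport-↭ (_ ∷ʳ _ ∷ʳ τ) (↭.swap x y p)
  with es , σ , π ← ⊆-transport-↭ τ p = es , y ∷ʳ x ∷ʳ σ , π
⊆-transport-↭ (_ ∷ʳ refl ∷ τ) (↭.swap x y p)
  with es , σ , π ← ⊆-transport-↭ τ p = y ∷ es , refl ∷ x ∷ʳ σ , ↭.prep y π
⊆-transport-↭ (refl ∷ _ ∷ʳ τ) (↭.swap x y p)
  with es , σ , π ← ⊆-transport-↭ τ p = x ∷ es , y ∷ʳ refl ∷ σ , ↭.prep x π
⊆-transport-↭ (refl ∷ refl ∷ τ) (↭.swap x y p)
  with es , σ , π ← ⊆-transport-↭ τ p = y ∷ x ∷ es , refl ∷ refl ∷ σ , ↭.swap y x π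
⊆-transport-↭ τ (↭.trans p q) with ⊆-transport-↭ τ p
... | es , σ , π with ⊆-transport-↭ σ q
...   | fs , ρ , π′ = fs , ρ , ↭-trans π′ π

unique∧set⇒↭ : ∀ {A : Set} {xs ys : List A} →
  Unique xs → Unique ys → (∀ {x} → x ∈ xs ⇔ x ∈ ys) → xs ↭ ys
unique∧set⇒↭ u v eq = ∼bag⇒↭ (unique∧set⇒bag u v eq)

sum-mono-⊆ : ∀ {xs ys : List ℕ} → xs ⊆ ys → sum xs ≤ sum ys
sum-mono-⊆ [] = z≤n
sum-mono-⊆ (y ∷ʳ τ) = ≤-trans (sum-mono-⊆ τ) (m≤n+m _ y)
sum-mono-⊆ (refl ∷ τ) = +-monoʳ-≤ _ (sum-mono-⊆ τ)

∈⇒≤sum : ∀ {x xs} → x ∈ xs → x ≤ sum xs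
∈⇒≤sum {xs = _ ∷ xs} (here refl) = m≤m+n _ (sum xs)
∈⇒≤sum {xs = y ∷ _} (there x∈xs) = ≤-trans (∈⇒≤sum x∈xs) (m≤n+m _ y)

sum-map-*ˡ : ∀ c xs → sum (map (c *_) xs) ≡ c * sum xs
sum-map-*ˡ c [] = sym (*-zeroʳ c)
sum-map-*ˡ c (x ∷ xs) =
  trans (cong (c * x +_) (sum-map-*ˡ c xs)) (sym (*-distribˡ-+ c x (sum xs)))

sum-++-map-* : ∀ c xs ys → sum (xs ++ map (c *_) ys) ≡ sum xs + c * sum ys
sum-++-map-* c xs ys = trans (sum-++ xs _) (cong (sum xs +_) (sum-map-*ˡ c ys))

Complete : List ℕ → Set
Complete ws = ∀ x → x ≤ sum ws → ∃[ ds ] (ds ⊆ ws × sum ds ≡ x)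

Complete-[1] : Complete (1 ∷ [])
Complete-[1] 0 _ = [] , 1 ∷ʳ [] , refl
Complete-[1] 1 _ = 1 ∷ [] , refl ∷ [] , refl
Complete-[1] (suc (suc x)) (s≤s ())

Complete-resp-↭ : ∀ {ws vs} → ws ↭ vs → Complete ws → Complete vs
Complete-resp-↭ π complete x x≤Σvs
  with ds , τ , refl ← complete x (subst (x ≤_) (sym (sum-↭ π)) x≤Σvs)
  with es , σ , π′ ← ⊆-transport-↭ τ π
  = es , σ , sum-↭ π′

-- Below c s the digits are the remainder and quotient of x by c; above it, b = s.
≤-+-*-split : ∀ {s c x} → 1 ≤ c → c ≤ s + 1 → x ≤ s + c * s →
  ∃₂ λ a b → a ≤ s × b ≤ s × x ≡ a + c * b
≤-+-*-split {s} {c} {x} 1≤c c≤s+1 x≤ with x ≤? c * s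
... | yes x≤cs = x % c , x / c , x%c≤s , x/c≤s , x≡
  where
  instance
    c≢0 : NonZero c
    c≢0 = >-nonZero 1≤c
  x%c≤s : x % c ≤ s
  x%c≤s = ≤-pred (≤-trans (m%n<n x c) (subst (c ≤_) (+-comm s 1) c≤s+1))
  x/c≤s : x / c ≤ s
  x/c≤s = subst (x / c ≤_) (trans (cong (_/ c) (*-comm c s)) (m*n/n≡m s c))
                (/-monoˡ-≤ c x≤cs)
  x≡ : x ≡ x % c + c * (x / c)
  x≡ = trans (m≡m%n+[m/n]*n x c) (cong (x % c +_) (*-comm (x / c) c))
... | no x≰cs =
  x ∸ c * s , s ,
  m≤n+o⇒m∸n≤o x (c * s) (subst (x ≤_) (+-comm s (c * s)) x≤) , ≤-refl ,
  sym (m∸n+n≡m (≰⇒≥ x≰cs))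

Complete-++-map-* : ∀ {c ws} → 1 ≤ c → c ≤ sum ws + 1 →
  Complete ws → Complete (ws ++ map (c *_) ws)
Complete-++-map-* {c} {ws} 1≤c c≤ complete x x≤
  with a , b , a≤ , b≤ , refl ←
         ≤-+-*-split 1≤c c≤ (subst (x ≤_) (sum-++-map-* c ws ws) x≤)
  with ds , τ , refl ← complete a a≤
  with es , σ , refl ← complete b b≤
  = ds ++ map (c *_) es , Sublist.++⁺ τ (Sublist.map⁺ (c *_) σ) , sum-++-map-* c ds es

Complete⇒FPractical : ∀ {f n} → Complete (map f (divisors n)) → FPractical f n
Complete⇒FPractical {f} complete x _ x≤
  with ds , τ , Σds≡x ← complete x x≤
  with es , σ , refl ← ⊆-map⁻ f τ
  = es , σ , Σds≡x

∣⇒≥1 : ∀ {d n} → 1 ≤ n → d ∣ n → 1 ≤ d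
∣⇒≥1 {zero} 1≤n 0∣n = ⊥-elim (<⇒≢ 1≤n (sym (0∣⇒≡0 0∣n)))
∣⇒≥1 {suc d} _ _ = s≤s z≤n

prime⇒≥1 : ∀ {p} → Prime p → 1 ≤ p
prime⇒≥1 {p} pp = >-nonZero⁻¹ p {{prime⇒nonZero pp}}

prime∤⇒coprime : ∀ {p n} → Prime p → ¬ p ∣ n → Coprime p n
prime∤⇒coprime pp p∤n (d∣p , d∣n) with prime⇒irreducible pp d∣p
... | inj₁ d≡1 = d≡1
... | inj₂ refl = ⊥-elim (p∤n d∣n)

∣-*-prime⁻ : ∀ {m p d} → Prime p →
  d ∣ m * p → d ∣ m ⊎ ∃[ e ] (e ∣ m × d ≡ p * e)
∣-*-prime⁻ {m} {p} {d} pp d∣mp with p ∣? d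
... | yes (divides e refl) =
  inj₂ (e , *-cancelʳ-∣ p {{prime⇒nonZero pp}} d∣mp , *-comm e p)
... | no p∤d = inj₁ (coprime-divisor (Coprime.sym (prime∤⇒coprime pp p∤d))
                                     (subst (d ∣_) (*-comm m p) d∣mp))

∣-*-product⁻ : ∀ {m d rs} → All Prime rs →
  d ∣ m * product rs → d ∣ m ⊎ ∃[ r ] (r ∈ rs × r ∣ d)
∣-*-product⁻ {m} {d} [] d∣m1 = inj₁ (subst (d ∣_) (*-identityʳ m) d∣m1)
∣-*-product⁻ {m} {d} {r ∷ rs} (pr ∷ prs) d∣mrR with r ∣? d
... | yes r∣d = inj₂ (r , here refl , r∣d)
... | no r∤d =
  Sum.map₂ (λ (r′ , r′∈rs , r′∣d) → r′ , there r′∈rs , r′∣d)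
    (∣-*-product⁻ prs (coprime-divisor (Coprime.sym (prime∤⇒coprime pr r∤d))
      (subst (d ∣_) (x∙yz≈y∙xz *-commutativeSemigroup m r (product rs)) d∣mrR)))

squarefree-*⇒∤ : ∀ {m q k} → Squarefree (m * (q * k)) → Prime q → ¬ q ∣ m
squarefree-*⇒∤ {m} {q} {k} sqf pq q∣m =
  sqf q pq (∣-trans (*-monoˡ-∣ q q∣m) (*-monoʳ-∣ m (m∣m*n k)))

∈-divisors⇔ : ∀ {n d} → 1 ≤ n → d ∈ divisors n ⇔ d ∣ n
∈-divisors⇔ {n} 1≤n = mk⇔ (proj₂ ∘ ∈-filter⁻ (_∣? n) {xs = applyUpTo suc n}) λ d∣n →
  ∈-filter⁺ (_∣? n) (∈-applyUpTo-suc (∣⇒≥1 1≤n d∣n) (∣⇒≤ {{>-nonZero 1≤n}} d∣n)) d∣n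
  where
  ∈-applyUpTo-suc : ∀ {i} → 1 ≤ i → i ≤ n → i ∈ applyUpTo suc n
  ∈-applyUpTo-suc {suc i} _ i<n = ∈-applyUpTo⁺ suc i<n

divisors-∣ : ∀ n → All (_∣ n) (divisors n)
divisors-∣ n = All.all-filter (_∣? n) (applyUpTo suc n)

divisors-unique : ∀ n → Unique (divisors n)
divisors-unique n =
  Unique.filter⁺ (_∣? n) (Unique.applyUpTo⁺₁ suc n (λ i<j _ → <⇒≢ (s<s i<j)))

divisors-*-prime-↭ : ∀ {m p} → 1 ≤ m → Prime p → ¬ p ∣ m →
  divisors (m * p) ↭ divisors m ++ map (p *_) (divisors m)
divisors-*-prime-↭ {m} {p} 1≤m pp p∤m = unique∧set⇒↭
  (divisors-unique (m * p))
  (Unique.++⁺ (divisors-unique m)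
              (Unique.map⁺ (*-cancelˡ-≡ _ _ p) (divisors-unique m))
              disjoint)
  (mk⇔ split join)
  where
  instance
    p≢0 : NonZero p
    p≢0 = prime⇒nonZero pp
  ∈m⇔ : ∀ {d} → d ∈ divisors m ⇔ d ∣ m
  ∈m⇔ = ∈-divisors⇔ 1≤m
  ∈mp⇔ : ∀ {d} → d ∈ divisors (m * p) ⇔ d ∣ m * p
  ∈mp⇔ = ∈-divisors⇔ (*-mono-≤ 1≤m (prime⇒≥1 pp))
  disjoint : Disjoint (divisors m) (map (p *_) (divisors m))
  disjoint (d∈ , pe∈) with e , _ , refl ← ∈-map⁻ (p *_) pe∈ =
    p∤m (∣-trans (m∣m*n e) (to ∈m⇔ d∈))
  split : ∀ {d} → d ∈ divisors (m * p) → d ∈ divisors m ++ map (p *_) (divisors m)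
  split d∈ with ∣-*-prime⁻ pp (to ∈mp⇔ d∈)
  ... | inj₁ d∣m = ∈-++⁺ˡ (from ∈m⇔ d∣m)
  ... | inj₂ (e , e∣m , refl) = ∈-++⁺ʳ (divisors m) (∈-map⁺ (p *_) (from ∈m⇔ e∣m))
  join : ∀ {d} → d ∈ divisors m ++ map (p *_) (divisors m) → d ∈ divisors (m * p)
  join d∈ with ∈-++⁻ (divisors m) d∈
  ... | inj₁ d∈m = from ∈mp⇔ (∣-trans (to ∈m⇔ d∈m) (m∣m*n p))
  ... | inj₂ pe∈ with e , e∈ , refl ← ∈-map⁻ (p *_) pe∈ =
    from ∈mp⇔ (subst (p * e ∣_) (*-comm p m) (*-monoʳ-∣ p (to ∈m⇔ e∈)))

filter-divisors-↭ : ∀ {m n} → 1 ≤ n → m ∣ n →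
  filter (_∣? m) (divisors n) ↭ divisors m
filter-divisors-↭ {m} {n} 1≤n m∣n = unique∧set⇒↭
  (Unique.filter⁺ (_∣? m) (divisors-unique n)) (divisors-unique m) (mk⇔ keep restore)
  where
  ∈m⇔ : ∀ {d} → d ∈ divisors m ⇔ d ∣ m
  ∈m⇔ = ∈-divisors⇔ (∣⇒≥1 1≤n m∣n)
  keep : ∀ {d} → d ∈ filter (_∣? m) (divisors n) → d ∈ divisors m
  keep = from ∈m⇔ ∘ proj₂ ∘ ∈-filter⁻ (_∣? m) {xs = divisors n}
  restore : ∀ {d} → d ∈ divisors m → d ∈ filter (_∣? m) (divisors n)
  restore d∈ =
    ∈-filter⁺ (_∣? m) (from (∈-divisors⇔ 1≤n) (∣-trans (to ∈m⇔ d∈) m∣n)) (to ∈m⇔ d∈)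

module _ (f : ℕ → ℕ) where

  S≡sum-filter : ∀ {m n} → 1 ≤ n → m ∣ n →
    S f m ≡ sum (map f (filter (_∣? m) (divisors n)))
  S≡sum-filter 1≤n m∣n = sym (sum-↭ (↭.map⁺ f (filter-divisors-↭ 1≤n m∣n)))

  S-mono-∣ : ∀ {m n} → 1 ≤ n → m ∣ n → S f m ≤ S f n
  S-mono-∣ {m} {n} 1≤n m∣n = ≤-trans (≤-reflexive (S≡sum-filter 1≤n m∣n))
    (sum-mono-⊆ (Sublist.map⁺ f (Sublist.filter-⊆ (_∣? m) (divisors n))))

  sum-≤-S : ∀ {m n ds} → 1 ≤ n → m ∣ n → ds ⊆ divisors n → All (_∣ m) ds →
    sum (map f ds) ≤ S f m
  sum-≤-S {m} {n} {ds} 1≤n m∣n τ ds∣m = begin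
    sum (map f ds)
      ≡⟨ cong (sum ∘ map f) (filter-all (_∣? m) ds∣m) ⟨
    sum (map f (filter (_∣? m) ds))
      ≤⟨ sum-mono-⊆ (Sublist.map⁺ f (Sublist.filter⁺ (_∣? m) (_∣? m) (λ { refl → id }) τ)) ⟩
    sum (map f (filter (_∣? m) (divisors n)))
      ≡⟨ S≡sum-filter 1≤n m∣n ⟨
    S f m ∎
    where open ≤-Reasoning

firstPowers : List ℕ → List (ℕ × ℕ)
firstPowers = map (_, 1)

IsOrderedPrimeFactorization : (ℕ → ℕ) → ℕ → List ℕ → Set
IsOrderedPrimeFactorization f n qs =
  All Prime qs × Linked (λ p q → f p ≤ f q) qs × product qs ≡ n

m*q^1*k≡m*[q*k] : ∀ m q k → m * q ^ 1 * k ≡ m * (q * k)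
m*q^1*k≡m*[q*k] m q k =
  trans (*-assoc m (q * 1) k) (cong (λ q′ → m * (q′ * k)) (*-identityʳ q))

product-firstPowers : ∀ qs →
  product (map (λ pe → proj₁ pe ^ proj₂ pe) (firstPowers qs)) ≡ product qs
product-firstPowers [] = refl
product-firstPowers (q ∷ qs) = cong₂ _*_ (*-identityʳ q) (product-firstPowers qs)

squarefree⇒firstPowers : ∀ {n} ps → Squarefree n →
  All (λ pe → Prime (proj₁ pe) × 1 ≤ proj₂ pe) ps →
  product (map (λ pe → proj₁ pe ^ proj₂ pe) ps) ∣ n →
  ps ≡ firstPowers (map proj₁ ps)
squarefree⇒firstPowers [] _ _ _ = refl
squarefree⇒firstPowers ((p , 1) ∷ ps) sqf (_ ∷ powers) p*P∣n = cong ((p , 1) ∷_)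
  (squarefree⇒firstPowers ps sqf powers (∣-trans (n∣m*n (p * 1)) p*P∣n))
squarefree⇒firstPowers ((p , suc (suc e)) ∷ ps) sqf ((pp , _) ∷ _) p^e*P∣n =
  ⊥-elim (sqf p pp (∣-trans (∣-trans (*-monoʳ-∣ p (m∣m*n (p ^ e))) (m∣m*n _)) p^e*P∣n))

primes-unique : ∀ {n qs} → Squarefree n → All Prime qs → product qs ∣ n → Unique qs
primes-unique sqf [] _ = []
primes-unique {qs = q ∷ qs} sqf (pq ∷ pqs) q*Q∣n =
  All.tabulate (λ r∈qs → λ { refl →
    sqf q pq (∣-trans (*-monoʳ-∣ q (∈⇒∣product r∈qs)) q*Q∣n) })
  ∷ primes-unique sqf pqs (∣-trans (n∣m*n q) q*Q∣n)

firstPowers⁻ : ∀ {f n} qs → IsOrderedFactorization f n (firstPowers qs) →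
  IsOrderedPrimeFactorization f n qs
firstPowers⁻ qs (powers , _ , sorted , prod) =
  All.map proj₁ (All.map⁻ powers) ,
  Linked.map⁻ sorted ,
  trans (sym (product-firstPowers qs)) prod

firstPowers⁺ : ∀ {f n} qs → Squarefree n → IsOrderedPrimeFactorization f n qs →
  IsOrderedFactorization f n (firstPowers qs)
firstPowers⁺ qs sqf (primes , sorted , prod) =
  All.map⁺ (All.map (_, s≤s z≤n) primes) ,
  subst Unique (trans (sym (map-id qs)) (map-∘ qs))
        (primes-unique sqf primes (∣-reflexive prod)) ,
  Linked.map⁺ sorted ,
  trans (product-firstPowers qs) prod

IsOrderedFactorization⇒firstPowers : ∀ {f n ps} → Squarefree n →
  IsOrderedFactorization f n ps →
  ∃[ qs ] (ps ≡ firstPowers qs × IsOrderedPrimeFactorization f n qs)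
IsOrderedFactorization⇒firstPowers {f} {n} {ps} sqf factorization@(powers , _ , _ , prod) =
  map proj₁ ps , ps≡ ,
  firstPowers⁻ (map proj₁ ps) (subst (IsOrderedFactorization f n) ps≡ factorization)
  where
  ps≡ : ps ≡ firstPowers (map proj₁ ps)
  ps≡ = squarefree⇒firstPowers ps sqf powers (∣-reflexive prod)

orderedPrimeFactorization : ∀ f {n} → 1 ≤ n → ∃[ qs ] IsOrderedPrimeFactorization f n qs
orderedPrimeFactorization f {n} 1≤n =
  sort ps ,
  ↭.All-resp-↭ (↭-sym (sort-↭ ps)) (PrimeFactorisation.factorsPrime factorisation) ,
  sort-↗ ps ,
  trans (product-↭ (sort-↭ ps)) (sym (PrimeFactorisation.isFactorisation factorisation))
  where
  open Data.List.Sort (On.decTotalOrder ≤-decTotalOrder f)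
  factorisation = factorise n {{>-nonZero 1≤n}}
  ps = PrimeFactorisation.factors factorisation

module _ {f : ℕ → ℕ} (pos : PositiveValued f) (mult : Multiplicative f) where

  f-*-prime : ∀ {p d} → Prime p → ¬ p ∣ d → 1 ≤ d → f (p * d) ≡ f p * f d
  f-*-prime pp p∤d 1≤d =
    proj₂ mult _ _ (prime⇒≥1 pp) 1≤d (prime∤⇒coprime pp p∤d)

  f-mono-prime-∣ : ∀ {r d} → Squarefree d → 1 ≤ d → Prime r → r ∣ d → f r ≤ f d
  f-mono-prime-∣ {r} sqf 1≤d pr (divides k refl) =
    subst (f r ≤_) (sym f[k*r]) (m≤n*m (f r) (f k) {{>-nonZero (pos k 1≤k)}})
    where
    1≤k : 1 ≤ k
    1≤k = ∣⇒≥1 1≤d (m∣m*n r)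
    r∤k : ¬ r ∣ k
    r∤k r∣k = sqf r pr (*-monoˡ-∣ r r∣k)
    f[k*r] : f (k * r) ≡ f k * f r
    f[k*r] = proj₂ mult k r 1≤k (prime⇒≥1 pr) (Coprime.sym (prime∤⇒coprime pr r∤k))

  map-divisors-*-prime-↭ : ∀ {m p} → 1 ≤ m → Prime p → ¬ p ∣ m →
    map f (divisors (m * p)) ↭ map f (divisors m) ++ map (f p *_) (map f (divisors m))
  map-divisors-*-prime-↭ {m} {p} 1≤m pp p∤m =
    ↭-trans (↭.map⁺ f (divisors-*-prime-↭ 1≤m pp p∤m)) (↭-reflexive (begin
      map f (divisors m ++ map (p *_) (divisors m))
        ≡⟨ map-++ f (divisors m) _ ⟩
      map f (divisors m) ++ map f (map (p *_) (divisors m))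
        ≡⟨ cong (map f (divisors m) ++_) (begin
             map f (map (p *_) (divisors m))
               ≡⟨ map-∘ (divisors m) ⟨
             map (f ∘ (p *_)) (divisors m)
               ≡⟨ map-cong-local (All.map f[p*d] (divisors-∣ m)) ⟩
             map ((f p *_) ∘ f) (divisors m)
               ≡⟨ map-∘ (divisors m) ⟩
             map (f p *_) (map f (divisors m)) ∎) ⟩
      map f (divisors m) ++ map (f p *_) (map f (divisors m)) ∎))
    where
    open ≡-Reasoning
    f[p*d] : ∀ {d} → d ∣ m → f (p * d) ≡ f p * f d
    f[p*d] d∣m = f-*-prime pp (λ p∣d → p∤m (∣-trans p∣d d∣m)) (∣⇒≥1 1≤m d∣m)

  S-*-prime : ∀ {m p} → 1 ≤ m → Prime p → ¬ p ∣ m →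
    S f (m * p) ≡ S f m + f p * S f m
  S-*-prime {m} {p} 1≤m pp p∤m = trans
    (sum-↭ (map-divisors-*-prime-↭ 1≤m pp p∤m))
    (sum-++-map-* (f p) (map f (divisors m)) (map f (divisors m)))

  Complete-*-prime : ∀ {m p} → 1 ≤ m → Prime p → ¬ p ∣ m → f p ≤ S f m + 1 →
    Complete (map f (divisors m)) → Complete (map f (divisors (m * p)))
  Complete-*-prime 1≤m pp p∤m fp≤ complete =
    Complete-resp-↭ (↭-sym (map-divisors-*-prime-↭ 1≤m pp p∤m))
      (Complete-++-map-* (pos _ (prime⇒≥1 pp)) fp≤ complete)

  Complete-divisors-1 : Complete (map f (divisors 1))
  Complete-divisors-1 = subst Complete (cong (_∷ []) (sym (proj₁ mult))) Complete-[1]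

  S≥1 : ∀ {m} → 1 ≤ m → 1 ≤ S f m
  S≥1 {m} 1≤m = subst (_≤ S f m) (cong (_+ 0) (proj₁ mult)) (S-mono-∣ f 1≤m (1∣ m))

  S+1≤S : ∀ {m q k} → 1 ≤ m * (q * k) → Squarefree (m * (q * k)) → Prime q →
    S f m + 1 ≤ S f (m * (q * k))
  S+1≤S {m} {q} {k} 1≤n sqf pq = begin
    S f m + 1
      ≤⟨ +-monoʳ-≤ (S f m) (*-mono-≤ (pos q (prime⇒≥1 pq)) (S≥1 1≤m)) ⟩
    S f m + f q * S f m
      ≡⟨ S-*-prime 1≤m pq (squarefree-*⇒∤ sqf pq) ⟨
    S f (m * q)
      ≤⟨ S-mono-∣ f 1≤n (*-monoʳ-∣ m (m∣m*n k)) ⟩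
    S f (m * (q * k)) ∎
    where
    open ≤-Reasoning
    1≤m : 1 ≤ m
    1≤m = ∣⇒≥1 1≤n (m∣m*n (q * k))

  small-divisor-∣ : ∀ {m q rs d} → 1 ≤ m * product rs → Squarefree (m * product rs) →
    All Prime rs → All (λ r → f q ≤ f r) rs →
    d ∣ m * product rs → f d < f q → d ∣ m
  small-divisor-∣ 1≤n sqf primes sorted d∣n fd<fq with ∣-*-product⁻ primes d∣n
  ... | inj₁ d∣m = d∣m
  ... | inj₂ (r , r∈rs , r∣d) = ⊥-elim (<⇒≱ fd<fq (≤-trans (All.lookup sorted r∈rs)
        (f-mono-prime-∣ (λ p pp p²∣d → sqf p pp (∣-trans p²∣d d∣n)) (∣⇒≥1 1≤n d∣n)
                        (All.lookup primes r∈rs) r∣d)))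

  sub-sum-bound : ∀ {m q rs ds} → let n = m * product (q ∷ rs) in
    1 ≤ n → Squarefree n → All Prime (q ∷ rs) → All (λ r → f q ≤ f r) (q ∷ rs) →
    ds ⊆ divisors n → sum (map f ds) < f q → sum (map f ds) ≤ S f m
  sub-sum-bound {m} {q} {rs} 1≤n sqf primes sorted τ Σds<fq =
    sum-≤-S f 1≤n (m∣m*n {m} (product (q ∷ rs))) τ (All.tabulate λ d∈ds →
      small-divisor-∣ {m} {q} {q ∷ rs} 1≤n sqf primes sorted
        (All.lookup (Sublist.All-resp-⊆ τ (divisors-∣ _)) d∈ds)
        (≤-<-trans (∈⇒≤sum (∈-map⁺ f d∈ds)) Σds<fq))

  FPractical⇒f≤S+1 : ∀ {m q rs} → let n = m * product (q ∷ rs) in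
    FPractical f n → 1 ≤ n → Squarefree n →
    All Prime (q ∷ rs) → All (λ r → f q ≤ f r) (q ∷ rs) → f q ≤ S f m + 1
  FPractical⇒f≤S+1 {m} {q} {rs} practical 1≤n sqf primes@(pq ∷ _) sorted
    with f q ≤? S f m + 1
  ... | yes fq≤ = fq≤
  ... | no fq≰
    with ds , τ , Σds≡ ← practical (S f m + 1) (m≤n+m 1 (S f m))
                                   (S+1≤S {m} {q} {product rs} 1≤n sqf pq)
    = ⊥-elim (m+1+n≰m (S f m) (subst (_≤ S f m) Σds≡
        (sub-sum-bound {m} {q} {rs} 1≤n sqf primes sorted τ
          (subst (_< f q) (sym Σds≡) (≰⇒> fq≰)))))

  FPractical⇒WeakCond : ∀ {n m} qs → FPractical f n → 1 ≤ n → Squarefree n →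
    m * product qs ≡ n → All Prime qs → Linked (λ p q → f p ≤ f q) qs →
    WeakCond f m (firstPowers qs)
  FPractical⇒WeakCond [] _ _ _ _ _ _ = tt
  FPractical⇒WeakCond {m = m} (q ∷ qs) practical 1≤n sqf refl primes sorted =
    FPractical⇒f≤S+1 {m} {q} {qs} practical 1≤n sqf primes
      (Linked.Linked⇒All ≤-trans ≤-refl sorted) ,
    FPractical⇒WeakCond qs practical 1≤n sqf (m*q^1*k≡m*[q*k] m q _)
      (All.tail primes) (Linked.tail sorted)

  WeakCond⇒Complete : ∀ {n m} qs → 1 ≤ n → Squarefree n →
    m * product qs ≡ n → All Prime qs → WeakCond f m (firstPowers qs) →
    Complete (map f (divisors m)) → Complete (map f (divisors n))
  WeakCond⇒Complete {m = m} [] _ _ m*1≡n _ _ complete =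
    subst (Complete ∘ map f ∘ divisors) (trans (sym (*-identityʳ m)) m*1≡n) complete
  WeakCond⇒Complete {m = m} (q ∷ qs) 1≤n sqf refl (pq ∷ pqs) (fq≤ , weak) complete =
    WeakCond⇒Complete qs 1≤n sqf (m*q^1*k≡m*[q*k] m q _) pqs weak
      (subst (Complete ∘ map f ∘ divisors) (cong (m *_) (sym (*-identityʳ q)))
        (Complete-*-prime {m} {q} (∣⇒≥1 1≤n (m∣m*n (q * product qs))) pq
          (squarefree-*⇒∤ sqf pq) fq≤ complete))

  FPractical⇒WeaklyFPractical : ∀ {n} → 1 ≤ n → Squarefree n →
    FPractical f n → WeaklyFPractical f n
  FPractical⇒WeaklyFPractical 1≤n sqf practical ps factorization
    with qs , refl , primes , sorted , prod ← IsOrderedFactorization⇒firstPowers sqf factorization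
    = FPractical⇒WeakCond qs practical 1≤n sqf (trans (*-identityˡ _) prod) primes sorted

  WeaklyFPractical⇒FPractical : ∀ {n} → 1 ≤ n → Squarefree n →
    WeaklyFPractical f n → FPractical f n
  WeaklyFPractical⇒FPractical {n} 1≤n sqf weak
    with qs , factorization@(primes , _ , prod) ← orderedPrimeFactorization f 1≤n
    = Complete⇒FPractical {f} {n}
        (WeakCond⇒Complete qs 1≤n sqf (trans (*-identityˡ _) prod) primes
          (weak (firstPowers qs) (firstPowers⁺ qs sqf factorization))
          Complete-divisors-1)

-- For squarefree n every exponent is 1.
corollary2p6 : (f : ℕ → ℕ) → PositiveValued f → Multiplicative f →
    (∀ p k → Prime p → 1 ≤ k → f (p ^ (k ∸ 1)) ≤ f (p ^ k)) →
    ∀ n → 1 ≤ n → Squarefree n → (FPractical f n ⇔ WeaklyFPractical f n)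
corollary2p6 f pos mult _ n 1≤n sqf =
  mk⇔ (FPractical⇒WeaklyFPractical pos mult 1≤n sqf)
      (WeaklyFPractical⇒FPractical pos mult 1≤n sqf)
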